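{- Let $n \ge 1$ be an integer and let $X_1,\dots,X_n$ be independent random variables, each geometrically distributed with $\Pr[X_i = k] = 2^{ -k}$ for $k=1,2,\dots$. Let $Z = \max_i X_i$. Then $$W(n) := \sum_{k \ge 1} \Pr[Z=k]\cdot \frac{1}{2^{k-1}} = \sum_{j=0}^{n} (-1)^j \binom{n}{j} \frac{1}{2^{j+1}-1}.$$ -}

module Defs where

open import Data.Nat as ℕ using (ℕ; zero; suc; _⊔_; _∸_)
open import Data.Nat.Combinatorics using (_C_)
open import Data.Integer as ℤ using (+_)
open import Data.Rational using (ℚ; 0ℚ; 1ℚ; ½; _+_; _*_; -_; _/_)
open import Data.List as List using (List; []; _∷_; concatMap; filterᵇ; upTo)
open import Data.Vec as Vec using (Vec)
open import Data.Bool using (Bool)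

_^ᵠ_ : ℚ → ℕ → ℚ
q ^ᵠ zero  = 1ℚ
q ^ᵠ suc k = q * (q ^ᵠ k)

sumℚ : List ℚ → ℚ
sumℚ = List.foldr _+_ 0ℚ

oneTo : ℕ → List ℕ
oneTo k = List.map suc (upTo k)

tuples : (n k : ℕ) → List (Vec ℕ n)
tuples zero    k = Vec.[] ∷ []
tuples (suc n) k = concatMap (λ x → List.map (x Vec.∷_) (tuples n k)) (oneTo k)

maxV : ∀ {n} → Vec ℕ n → ℕ
maxV = Vec.foldr _ _⊔_ 0

jointPmf : ∀ {n} → Vec ℕ n → ℚ
jointPmf = Vec.foldr _ (λ x acc → (½ ^ᵠ x) * acc) 1ℚ

-- Pr[Z = k] where Z = max Xᵢ : sum of the joint pmf over all outcomes
-- x ∈ {1,2,…}ⁿ with max x = k (all such x lie in {1,…,k}ⁿ).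
PrZ : (n k : ℕ) → ℚ
PrZ n k = sumℚ (List.map jointPmf (filterᵇ (λ x → maxV x ℕ.≡ᵇ k) (tuples n k)))

Wpartial : (n N : ℕ) → ℚ
Wpartial n N = sumℚ (List.map (λ k → PrZ n k * (½ ^ᵠ (k ∸ 1))) (oneTo N))

sign : ℕ → ℚ
sign j = (- 1ℚ) ^ᵠ j

-- 1/(2^{j+1} - 1), with the (positive) denominator written as suc (2^{j+1} ∸ 2)
invDen : ℕ → ℚ
invDen j = + 1 / suc (2 ℕ.^ suc j ∸ 2)

RHS : ℕ → ℚ
RHS n = sumℚ (List.map (λ j → sign j * ((+ (n C j) / 1) * invDen j)) (upTo (suc n)))

module Submission where

-- Write cⱼ = (-1)ʲ C(n,j), qⱼ = 2^{-(j+1)} and dⱼ = 1/(2^{j+1}-1) - 1.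
--  * Probability: Pr[Xᵢ ≤ k] = 1 - 2⁻ᵏ, hence Pr[Z ≤ k] = (1 - 2⁻ᵏ)ⁿ and
--    Pr[Z = k+1] = (1 - 2^{-(k+1)})ⁿ - (1 - 2⁻ᵏ)ⁿ, computed by recursion on n over the
--    explicit list of outcomes used in the definition of Pr[Z = k].
--  * Algebra: expanding both powers with the binomial theorem of the standard library
--    gives Pr[Z = N+1]·2^{-N} = Σⱼ cⱼ (2⁻ʲ - 1) qⱼᴺ, and since dⱼ (1 - qⱼ) = 2⁻ʲ - 1 these
--    terms telescope: W_N = L - E_N with L = Σⱼ cⱼ dⱼ and E_N = Σⱼ cⱼ dⱼ qⱼᴺ.
--  * L = R because Σⱼ cⱼ = (1 - 1)ⁿ = 0 for n ≥ 1.
--  * |E_N| ≤ (Σⱼ |cⱼ dⱼ|)·2^{-N}, which is eventually below any ε > 0 by the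
--    Archimedean property of ℚ.

open import Defs
open import Algebra.Bundles using (CommutativeRing; CommutativeSemiring)
open import Data.Nat as ℕ using (ℕ; zero; suc; _⊔_; _∸_; _≡ᵇ_; z≤n; s≤s)
import Data.Nat.Properties as ℕₚ
open import Data.Nat.Combinatorics using (_C_)
open import Data.Integer as ℤ using (-[1+_]; +<+; +≤+; -≤+)
import Data.Integer.Properties as ℤₚ
open import Data.Rational
  using (ℚ; mkℚ; 0ℚ; 1ℚ; ½; _+_; _*_; -_; _-_; _/_; ∣_∣; _≤_; _<_; toℚᵘ; nonNegative; positive; *<*)
import Data.Rational.Properties as ℚₚ
import Data.Rational.Unnormalised as ℚᵘ
import Data.Rational.Unnormalised.Properties as ℚᵘₚ
open import Data.Rational.Solver using (module +-*-Solver)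
open +-*-Solver
import Data.Nat.Coprimality as Coprimality
open import Data.List as List
  using (List; []; _∷_; _++_; [_]; map; upTo; applyUpTo; concatMap; filterᵇ)
import Data.List.Properties as Listₚ
open import Data.List.Relation.Unary.All as All using (All)
import Data.List.Relation.Unary.All.Properties as Allₚ
open import Data.Vec as Vec using (Vec)
open import Data.Fin using (toℕ)
open import Data.Bool using (Bool; true; false; T)
open import Data.Bool.Properties using (T?)
open import Data.Product using (∃; _,_)
open import Function using (_∘_)
open import Relation.Binary.PropositionalEquality hiding ([_])

-- ℚ as a commutative semiring, to use the library's powers, multiples and binomial theorem.
ℚ-semiring : CommutativeSemiring _ _
ℚ-semiring = CommutativeRing.commutativeSemiring ℚₚ.+-*-commutativeRing

open import Algebra.Definitions.RawSemiring (CommutativeSemiring.rawSemiring ℚ-semiring)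
  using (sum)
open import Algebra.Properties.Semiring.Mult (CommutativeSemiring.semiring ℚ-semiring)
  using (_×_; ×-assoc-*; ×1-homo-*; ×-homo-+)
open import Algebra.Properties.CommutativeSemiring.Exp ℚ-semiring
  using (_^_; ^-distrib-*; ^-assocʳ)
import Algebra.Properties.CommutativeSemiring.Binomial ℚ-semiring as Binomial

sum-cong : ∀ {A : Set} {f g : A → ℚ} → (∀ x → f x ≡ g x) → ∀ xs →
           sumℚ (map f xs) ≡ sumℚ (map g xs)
sum-cong f≗g xs = cong sumℚ (Listₚ.map-cong f≗g xs)

sum-cong-All : ∀ {A : Set} {f g : A → ℚ} {xs : List A} → All (λ x → f x ≡ g x) xs →
               sumℚ (map f xs) ≡ sumℚ (map g xs)
sum-cong-All eqs = cong sumℚ (Listₚ.map-cong-local eqs)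

sum-++ : ∀ xs ys → sumℚ (xs ++ ys) ≡ sumℚ xs + sumℚ ys
sum-++ []       ys = sym (ℚₚ.+-identityˡ (sumℚ ys))
sum-++ (x ∷ xs) ys = trans (cong (_+_ x) (sum-++ xs ys)) (sym (ℚₚ.+-assoc x (sumℚ xs) (sumℚ ys)))

sum-+ : ∀ {A : Set} (f g : A → ℚ) xs →
        sumℚ (map (λ x → f x + g x) xs) ≡ sumℚ (map f xs) + sumℚ (map g xs)
sum-+ f g []       = refl
sum-+ f g (x ∷ xs) rewrite sum-+ f g xs =
  solve 4 (λ a b c d → (a :+ b) :+ (c :+ d) := (a :+ c) :+ (b :+ d)) refl
          (f x) (g x) (sumℚ (map f xs)) (sumℚ (map g xs))

sum-- : ∀ {A : Set} (f g : A → ℚ) xs →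
        sumℚ (map (λ x → f x - g x) xs) ≡ sumℚ (map f xs) - sumℚ (map g xs)
sum-- f g []       = refl
sum-- f g (x ∷ xs) rewrite sum-- f g xs =
  solve 4 (λ a b c d → (a :- b) :+ (c :- d) := (a :+ c) :- (b :+ d)) refl
          (f x) (g x) (sumℚ (map f xs)) (sumℚ (map g xs))

sum-*ˡ : ∀ {A : Set} c (f : A → ℚ) xs → sumℚ (map (λ x → c * f x) xs) ≡ c * sumℚ (map f xs)
sum-*ˡ c f []       = sym (ℚₚ.*-zeroʳ c)
sum-*ˡ c f (x ∷ xs) rewrite sum-*ˡ c f xs = sym (ℚₚ.*-distribˡ-+ c (f x) (sumℚ (map f xs)))

sum-*ʳ : ∀ {A : Set} c (f : A → ℚ) xs → sumℚ (map (λ x → f x * c) xs) ≡ sumℚ (map f xs) * c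
sum-*ʳ c f xs = trans (sum-cong (λ x → ℚₚ.*-comm (f x) c) xs)
                      (trans (sum-*ˡ c f xs) (ℚₚ.*-comm c (sumℚ (map f xs))))

sum-mono-≤ : ∀ {A : Set} {f g : A → ℚ} → (∀ x → f x ≤ g x) → ∀ xs →
             sumℚ (map f xs) ≤ sumℚ (map g xs)
sum-mono-≤ f≤g []       = ℚₚ.≤-refl
sum-mono-≤ f≤g (x ∷ xs) = ℚₚ.+-mono-≤ (f≤g x) (sum-mono-≤ f≤g xs)

sum-abs : ∀ {A : Set} (f : A → ℚ) xs → ∣ sumℚ (map f xs) ∣ ≤ sumℚ (map (∣_∣ ∘ f) xs)
sum-abs f []       = ℚₚ.≤-refl
sum-abs f (x ∷ xs) =
  ℚₚ.≤-trans (ℚₚ.∣p+q∣≤∣p∣+∣q∣ (f x) _) (ℚₚ.+-monoʳ-≤ ∣ f x ∣ (sum-abs f xs))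

sum-oneTo-suc : ∀ (f : ℕ → ℚ) k →
                sumℚ (map f (oneTo (suc k))) ≡ sumℚ (map f (oneTo k)) + f (suc k)
sum-oneTo-suc f k = begin
  sumℚ (map f (map suc (upTo (suc k))))      ≡⟨ cong (sumℚ ∘ map f ∘ map suc) (sym (Listₚ.upTo-∷ʳ k)) ⟩
  sumℚ (map f (map suc (upTo k ++ [ k ])))   ≡⟨ cong (sumℚ ∘ map f) (Listₚ.map-++ suc (upTo k) [ k ]) ⟩
  sumℚ (map f (oneTo k ++ [ suc k ]))        ≡⟨ cong sumℚ (Listₚ.map-++ f (oneTo k) [ suc k ]) ⟩
  sumℚ (map f (oneTo k) ++ [ f (suc k) ])    ≡⟨ sum-++ (map f (oneTo k)) [ f (suc k) ] ⟩
  sumℚ (map f (oneTo k)) + (f (suc k) + 0ℚ)  ≡⟨ cong (_+_ (sumℚ (map f (oneTo k)))) (ℚₚ.+-identityʳ (f (suc k))) ⟩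
  sumℚ (map f (oneTo k)) + f (suc k)         ∎
  where open ≡-Reasoning

sum-applyUpTo : ∀ m (f : ℕ → ℚ) → sum {m} (f ∘ toℕ) ≡ sumℚ (applyUpTo f m)
sum-applyUpTo zero    f = refl
sum-applyUpTo (suc m) f = cong (_+_ (f 0)) (sum-applyUpTo m (f ∘ suc))

^ᵠ-is-^ : ∀ q k → q ^ᵠ k ≡ q ^ k
^ᵠ-is-^ q zero    = refl
^ᵠ-is-^ q (suc k) = cong (q *_) (^ᵠ-is-^ q k)

^ᵠ-distrib-* : ∀ x y k → (x * y) ^ᵠ k ≡ x ^ᵠ k * y ^ᵠ k
^ᵠ-distrib-* x y k
  rewrite ^ᵠ-is-^ (x * y) k | ^ᵠ-is-^ x k | ^ᵠ-is-^ y k = ^-distrib-* x y k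

^ᵠ-comm : ∀ x a b → (x ^ᵠ a) ^ᵠ b ≡ (x ^ᵠ b) ^ᵠ a
^ᵠ-comm x a b rewrite ^ᵠ-is-^ (x ^ᵠ a) b | ^ᵠ-is-^ x a | ^ᵠ-is-^ (x ^ᵠ b) a | ^ᵠ-is-^ x b =
  trans (^-assocʳ x a b) (trans (cong (x ^_) (ℕₚ.*-comm a b)) (sym (^-assocʳ x b a)))

1^ᵠ : ∀ k → 1ℚ ^ᵠ k ≡ 1ℚ
1^ᵠ zero    = refl
1^ᵠ (suc k) = cong (_*_ 1ℚ) (1^ᵠ k)

*-monoˡ-≤ : ∀ {a b} c → 0ℚ ≤ c → a ≤ b → c * a ≤ c * b
*-monoˡ-≤ c 0≤c = ℚₚ.*-monoˡ-≤-nonNeg c {{nonNegative 0≤c}}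

*-monoʳ-≤ : ∀ {a b} c → 0ℚ ≤ c → a ≤ b → a * c ≤ b * c
*-monoʳ-≤ c 0≤c = ℚₚ.*-monoʳ-≤-nonNeg c {{nonNegative 0≤c}}

^ᵠ-nonNeg : ∀ {x} → 0ℚ ≤ x → ∀ k → 0ℚ ≤ x ^ᵠ k
^ᵠ-nonNeg 0≤x zero    = ℚₚ.nonNegative⁻¹ 1ℚ
^ᵠ-nonNeg {x} 0≤x (suc k) =
  ℚₚ.≤-trans (ℚₚ.≤-reflexive (sym (ℚₚ.*-zeroˡ (x ^ᵠ k)))) (*-monoʳ-≤ (x ^ᵠ k) (^ᵠ-nonNeg 0≤x k) 0≤x)

^ᵠ-mono-≤ : ∀ {x y} → 0ℚ ≤ x → x ≤ y → ∀ k → x ^ᵠ k ≤ y ^ᵠ k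
^ᵠ-mono-≤ 0≤x x≤y zero    = ℚₚ.≤-refl
^ᵠ-mono-≤ {x} {y} 0≤x x≤y (suc k) =
  ℚₚ.≤-trans (*-monoʳ-≤ (x ^ᵠ k) (^ᵠ-nonNeg 0≤x k) x≤y)
             (*-monoˡ-≤ y (ℚₚ.≤-trans 0≤x x≤y) (^ᵠ-mono-≤ 0≤x x≤y k))

^ᵠ-antitone : ∀ {x} → 0ℚ ≤ x → x ≤ 1ℚ → ∀ {K N} → K ℕ.≤ N → x ^ᵠ N ≤ x ^ᵠ K
^ᵠ-antitone 0≤x x≤1 {N = zero}  z≤n = ℚₚ.≤-refl
^ᵠ-antitone {x} 0≤x x≤1 {N = suc N} z≤n =
  ℚₚ.≤-trans (*-monoʳ-≤ (x ^ᵠ N) (^ᵠ-nonNeg 0≤x N) x≤1)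
             (ℚₚ.≤-trans (ℚₚ.≤-reflexive (ℚₚ.*-identityˡ (x ^ᵠ N))) (^ᵠ-antitone 0≤x x≤1 {N = N} z≤n))
^ᵠ-antitone {x} 0≤x x≤1 (s≤s K≤N) = *-monoˡ-≤ x 0≤x (^ᵠ-antitone 0≤x x≤1 K≤N)

0≤½ : 0ℚ ≤ ½
0≤½ = ℚₚ.nonNegative⁻¹ ½

½≤1 : ½ ≤ 1ℚ
½≤1 = ℚₚ.toℚᵘ-cancel-≤ (ℚᵘ.*≤* (+≤+ (s≤s z≤n)))

½^ᵠ-pos : ∀ k → 0ℚ < ½ ^ᵠ k
½^ᵠ-pos zero    = ℚₚ.positive⁻¹ 1ℚ
½^ᵠ-pos (suc k) = ℚₚ.<-respˡ-≡ (ℚₚ.*-zeroʳ ½) (ℚₚ.*-monoʳ-<-pos ½ (½^ᵠ-pos k))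

ι : ℕ → ℚ
ι m = ℤ.+ m / 1

ι-as-mkℚ : ∀ m → ι m ≡ mkℚ (ℤ.+ m) 0 (Coprimality.sym (Coprimality.1-coprimeTo m))
ι-as-mkℚ m = ℚₚ.normalize-coprime (Coprimality.sym (Coprimality.1-coprimeTo m))

ι-suc : ∀ m → ι (suc m) ≡ 1ℚ + ι m
ι-suc m = ℚₚ.toℚᵘ-injective (begin
  toℚᵘ (ι (suc m))                  ≡⟨ cong toℚᵘ (ι-as-mkℚ (suc m)) ⟩
  ℚᵘ.mkℚᵘ (ℤ.+ suc m) 0             ≈⟨ ℚᵘ.*≡* cross-multiplied ⟩
  toℚᵘ 1ℚ ℚᵘ.+ ℚᵘ.mkℚᵘ (ℤ.+ m) 0    ≡⟨ cong (toℚᵘ 1ℚ ℚᵘ.+_) (cong toℚᵘ (ι-as-mkℚ m)) ⟨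
  toℚᵘ 1ℚ ℚᵘ.+ toℚᵘ (ι m)           ≈⟨ ℚₚ.toℚᵘ-homo-+ 1ℚ (ι m) ⟨
  toℚᵘ (1ℚ + ι m)                   ∎)
  where
  open ℚᵘₚ.≃-Reasoning
  -- (1+m)/1 = 1/1 + m/1, cross-multiplied
  cross-multiplied : ℤ.+ suc m ℤ.* ℤ.+ 1 ≡ (ℤ.+ 1 ℤ.* ℤ.+ 1 ℤ.+ ℤ.+ m ℤ.* ℤ.+ 1) ℤ.* ℤ.+ 1
  cross-multiplied = cong (λ z → (ℤ.+ 1 ℤ.+ z) ℤ.* ℤ.+ 1) (sym (ℤₚ.*-identityʳ (ℤ.+ m)))

-- ι m is the m-fold multiple of 1, so it is a semiring homomorphism.
ι-is-× : ∀ m → m × 1ℚ ≡ ι m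
ι-is-× zero    = refl
ι-is-× (suc m) = trans (cong (_+_ 1ℚ) (ι-is-× m)) (sym (ι-suc m))

×-is-ι* : ∀ m x → m × x ≡ ι m * x
×-is-ι* m x = begin
  m × x          ≡⟨ cong (m ×_) (ℚₚ.*-identityˡ x) ⟨
  m × (1ℚ * x)   ≡⟨ ×-assoc-* m 1ℚ x ⟨
  (m × 1ℚ) * x   ≡⟨ cong (_* x) (ι-is-× m) ⟩
  ι m * x        ∎
  where open ≡-Reasoning

ι-+ : ∀ a b → ι (a ℕ.+ b) ≡ ι a + ι b
ι-+ a b rewrite sym (ι-is-× (a ℕ.+ b)) | sym (ι-is-× a) | sym (ι-is-× b) = ×-homo-+ 1ℚ a b

ι-* : ∀ a b → ι (a ℕ.* b) ≡ ι a * ι b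
ι-* a b rewrite sym (ι-is-× (a ℕ.* b)) | sym (ι-is-× a) | sym (ι-is-× b) = ×1-homo-* a b

ι-mono : ∀ {a b} → a ℕ.≤ b → ι a ≤ ι b
ι-mono {a} a≤b with d , refl ← ℕₚ.m≤n⇒∃[o]m+o≡n a≤b = begin
  ι a          ≡⟨ ℚₚ.+-identityʳ (ι a) ⟨
  ι a + 0ℚ     ≤⟨ ℚₚ.+-monoʳ-≤ (ι a) (ℚₚ.nonNegative⁻¹ (ι d) {{ℚₚ.normalize-nonNeg d 1}}) ⟩
  ι a + ι d    ≡⟨ ι-+ a d ⟨
  ι (a ℕ.+ d)  ∎
  where open ℚₚ.≤-Reasoning

2^-inverse : ∀ m → ι (2 ℕ.^ m) * ½ ^ᵠ m ≡ 1ℚ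
2^-inverse zero    = refl
2^-inverse (suc m) = begin
  ι (2 ℕ.* 2 ℕ.^ m) * (½ * ½ ^ᵠ m)    ≡⟨ cong (_* (½ * ½ ^ᵠ m)) (ι-* 2 (2 ℕ.^ m)) ⟩
  (ι 2 * ι (2 ℕ.^ m)) * (½ * ½ ^ᵠ m)  ≡⟨ solve 4 (λ a b c d → (a :* b) :* (c :* d) := (a :* c) :* (b :* d))
                                                  refl (ι 2) (ι (2 ℕ.^ m)) ½ (½ ^ᵠ m) ⟩
  (ι 2 * ½) * (ι (2 ℕ.^ m) * ½ ^ᵠ m)  ≡⟨ cong (_*_ 1ℚ) (2^-inverse m) ⟩
  1ℚ * 1ℚ                             ∎
  where open ≡-Reasoning

ι-inverse : ∀ m → ι (suc m) * (ℤ.+ 1 / suc m) ≡ 1ℚ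
ι-inverse m = begin
  ι (suc m) * (ℤ.+ 1 / suc m)  ≡⟨ cong₂ _*_ (ι-as-mkℚ (suc m)) (ℚₚ.normalize-coprime c) ⟩
  p * mkℚ (ℤ.+ 1) m c          ≡⟨ ℚₚ.*-inverseʳ p ⟩
  1ℚ                           ∎
  where open ≡-Reasoning
        c = Coprimality.1-coprimeTo (suc m)
        p = mkℚ (ℤ.+ suc m) 0 (Coprimality.sym c)

invDen-inverse : ∀ j → (ι (2 ℕ.^ suc j) - 1ℚ) * invDen j ≡ 1ℚ
invDen-inverse j with 2 ℕ.^ suc j | ℕₚ.*-monoʳ-≤ 2 (ℕₚ.m^n>0 2 j)
... | suc zero    | s≤s ()
... | suc (suc m) | _ = begin
  (ι (suc (suc m)) - 1ℚ) * (ℤ.+ 1 / suc m)   ≡⟨ cong (λ z → (z - 1ℚ) * (ℤ.+ 1 / suc m)) (ι-suc (suc m)) ⟩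
  (1ℚ + ι (suc m) - 1ℚ) * (ℤ.+ 1 / suc m)    ≡⟨ cong (_* (ℤ.+ 1 / suc m))
                                                     (solve 1 (λ x → con 1ℚ :+ x :- con 1ℚ := x) refl (ι (suc m))) ⟩
  ι (suc m) * (ℤ.+ 1 / suc m)                ≡⟨ ι-inverse m ⟩
  1ℚ                                         ∎
  where open ≡-Reasoning

i≤+∣i∣ : ∀ i → i ℤ.≤ ℤ.+ ℤ.∣ i ∣
i≤+∣i∣ (ℤ.+ n)    = ℤₚ.≤-refl
i≤+∣i∣ -[1+ n ]   = -≤+

archimedean : ∀ x ε → 0ℚ < ε → ∃ λ K → x < ε * ι K
archimedean x (mkℚ (ℤ.+ zero) _ _) (*<* (+<+ ()))
archimedean x (mkℚ -[1+ _ ] _ _)   (*<* ())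
archimedean x@(mkℚ a b _) ε@(mkℚ (ℤ.+ suc c) d _) _ =
  K , ℚₚ.toℚᵘ-cancel-< (ℚᵘₚ.<-respʳ-≃ (ℚᵘₚ.≃-sym (ℚₚ.toℚᵘ-homo-* ε (ι K))) x<εK)
  where
  D = suc (d ℕ.* 1)            -- the denominator of ε·K, namely (d+1)·1
  K = suc (ℤ.∣ a ∣ ℕ.* D)
  -- a·(d+1) ≤ |a|·(d+1) < K ≤ (c+1)·K·(b+1): the cross-multiplied form of x < ε·K.
  x<εK : toℚᵘ x ℚᵘ.< toℚᵘ ε ℚᵘ.* toℚᵘ (ι K)
  x<εK rewrite cong toℚᵘ (ι-as-mkℚ K) = ℚᵘ.*<* (begin-strict
    a ℤ.* ℤ.+ D                   ≤⟨ i≤+∣i∣ (a ℤ.* ℤ.+ D) ⟩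
    ℤ.+ ℤ.∣ a ℤ.* ℤ.+ D ∣         ≡⟨ cong ℤ.+_ (ℤₚ.∣i*j∣≡∣i∣*∣j∣ a (ℤ.+ D)) ⟩
    ℤ.+ (ℤ.∣ a ∣ ℕ.* D)           <⟨ +<+ ℕₚ.≤-refl ⟩
    ℤ.+ K                         ≤⟨ +≤+ (ℕₚ.≤-trans (ℕₚ.m≤n*m K (suc c)) (ℕₚ.m≤m*n (suc c ℕ.* K) (suc b))) ⟩
    ℤ.+ (suc c ℕ.* K ℕ.* suc b)   ∎)
    where open ℤₚ.≤-Reasoning

n<2^n : ∀ n → n ℕ.< 2 ℕ.^ n
n<2^n zero    = s≤s z≤n
n<2^n (suc n) = begin
  suc (suc n)                  ≡⟨ ℕₚ.+-comm 1 (suc n) ⟩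
  suc n ℕ.+ 1                  ≤⟨ ℕₚ.+-mono-≤ (n<2^n n) (ℕₚ.m^n>0 2 n) ⟩
  2 ℕ.^ n ℕ.+ 2 ℕ.^ n          ≡⟨ cong (2 ℕ.^ n ℕ.+_) (ℕₚ.+-identityʳ (2 ℕ.^ n)) ⟨
  2 ℕ.^ n ℕ.+ (2 ℕ.^ n ℕ.+ 0)  ∎
  where open ℕₚ.≤-Reasoning

eventually-small : ∀ M ε → 0ℚ < ε → ∃ λ K → M * ½ ^ᵠ K < ε
eventually-small M ε 0<ε with K , M<εK ← archimedean M ε 0<ε = K , (begin-strict
  M * ½ ^ᵠ K                   <⟨ ℚₚ.*-monoˡ-<-pos (½ ^ᵠ K) {{positive (½^ᵠ-pos K)}} M<εK ⟩
  ε * ι K * ½ ^ᵠ K             ≤⟨ *-monoʳ-≤ (½ ^ᵠ K) (^ᵠ-nonNeg 0≤½ K)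
                                     (*-monoˡ-≤ ε (ℚₚ.<⇒≤ 0<ε) (ι-mono (ℕₚ.<⇒≤ (n<2^n K)))) ⟩
  ε * ι (2 ℕ.^ K) * ½ ^ᵠ K     ≡⟨ ℚₚ.*-assoc ε (ι (2 ℕ.^ K)) (½ ^ᵠ K) ⟩
  ε * (ι (2 ℕ.^ K) * ½ ^ᵠ K)   ≡⟨ cong (ε *_) (2^-inverse K) ⟩
  ε * 1ℚ                       ≡⟨ ℚₚ.*-identityʳ ε ⟩
  ε                            ∎)
  where open ℚₚ.≤-Reasoning

signedBinom : ℕ → ℕ → ℚ
signedBinom n j = sign j * ι (n C j)

neg-^ᵠ : ∀ t k → (- t) ^ᵠ k ≡ sign k * t ^ᵠ k
neg-^ᵠ t k = trans (cong (_^ᵠ k) (solve 1 (λ x → :- x := con (- 1ℚ) :* x) refl t)) (^ᵠ-distrib-* (- 1ℚ) t k)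

binomial : ∀ n t → (1ℚ - t) ^ᵠ n ≡ sumℚ (map (λ j → signedBinom n j * t ^ᵠ j) (upTo (suc n)))
binomial n t = begin
  (1ℚ - t) ^ᵠ n                                 ≡⟨ cong (_^ᵠ n) (ℚₚ.+-comm 1ℚ (- t)) ⟩
  (- t + 1ℚ) ^ᵠ n                               ≡⟨ ^ᵠ-is-^ (- t + 1ℚ) n ⟩
  (- t + 1ℚ) ^ n                                ≡⟨ Binomial.theorem n (- t) 1ℚ ⟩
  sum {suc n} (term ∘ toℕ)                      ≡⟨ sum-applyUpTo (suc n) term ⟩
  sumℚ (applyUpTo term (suc n))                 ≡⟨ cong sumℚ (Listₚ.map-upTo term (suc n)) ⟨
  sumℚ (map term (upTo (suc n)))                ≡⟨ sum-cong term-value (upTo (suc n)) ⟩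
  sumℚ (map (λ j → signedBinom n j * t ^ᵠ j) (upTo (suc n))) ∎
  where
  open ≡-Reasoning
  term : ℕ → ℚ
  term j = (n C j) × ((- t) ^ j * 1ℚ ^ (n ∸ j))
  term-value : ∀ j → term j ≡ signedBinom n j * t ^ᵠ j
  term-value j = begin
    (n C j) × ((- t) ^ j * 1ℚ ^ (n ∸ j))      ≡⟨ ×-is-ι* (n C j) _ ⟩
    ι (n C j) * ((- t) ^ j * 1ℚ ^ (n ∸ j))    ≡⟨ cong₂ (λ a b → ι (n C j) * (a * b))
                                                   (trans (sym (^ᵠ-is-^ (- t) j)) (neg-^ᵠ t j))
                                                   (trans (sym (^ᵠ-is-^ 1ℚ (n ∸ j))) (1^ᵠ (n ∸ j))) ⟩
    ι (n C j) * ((sign j * t ^ᵠ j) * 1ℚ)      ≡⟨ solve 3 (λ c s x → c :* ((s :* x) :* con 1ℚ) := (s :* c) :* x)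
                                                   refl (ι (n C j)) (sign j) (t ^ᵠ j) ⟩
    signedBinom n j * t ^ᵠ j                  ∎

signedBinom-sum : ∀ m → sumℚ (map (signedBinom (suc m)) (upTo (suc (suc m)))) ≡ 0ℚ
signedBinom-sum m = begin
  sumℚ (map (signedBinom (suc m)) js)                         ≡⟨ sum-cong unit js ⟩
  sumℚ (map (λ j → signedBinom (suc m) j * 1ℚ ^ᵠ j) js)       ≡⟨ binomial (suc m) 1ℚ ⟨
  (1ℚ - 1ℚ) ^ᵠ suc m                                          ≡⟨ ℚₚ.*-zeroˡ ((1ℚ - 1ℚ) ^ᵠ m) ⟩
  0ℚ                                                          ∎
  where
  open ≡-Reasoning
  js = upTo (suc (suc m))
  unit : ∀ j → signedBinom (suc m) j ≡ signedBinom (suc m) j * 1ℚ ^ᵠ j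
  unit j = sym (trans (cong (signedBinom (suc m) j *_) (1^ᵠ j)) (ℚₚ.*-identityʳ _))

-- The distribution of Z = max Xᵢ.

cdf : ℕ → ℚ
cdf k = sumℚ (map (½ ^ᵠ_) (oneTo k))

cdf-closed : ∀ k → cdf k ≡ 1ℚ - ½ ^ᵠ k
cdf-closed zero    = refl
cdf-closed (suc k) = begin
  cdf (suc k)                     ≡⟨ sum-oneTo-suc (½ ^ᵠ_) k ⟩
  cdf k + ½ * ½ ^ᵠ k              ≡⟨ cong (_+ ½ * ½ ^ᵠ k) (cdf-closed k) ⟩
  (1ℚ - ½ ^ᵠ k) + ½ * ½ ^ᵠ k      ≡⟨ solve 1 (λ y → (con 1ℚ :- y) :+ con ½ :* y := con 1ℚ :- con ½ :* y) refl (½ ^ᵠ k) ⟩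
  1ℚ - ½ * ½ ^ᵠ k                 ∎
  where open ≡-Reasoning

mass : ∀ {n} → (Vec ℕ n → Bool) → List (Vec ℕ n) → ℚ
mass P vs = sumℚ (map jointPmf (filterᵇ P vs))

mass-++ : ∀ {n} (P : Vec ℕ n → Bool) xs ys → mass P (xs ++ ys) ≡ mass P xs + mass P ys
mass-++ P xs ys = begin
  sumℚ (map jointPmf (filterᵇ P (xs ++ ys)))                   ≡⟨ cong (sumℚ ∘ map jointPmf) (Listₚ.filter-++ (T? ∘ P) xs ys) ⟩
  sumℚ (map jointPmf (filterᵇ P xs ++ filterᵇ P ys))           ≡⟨ cong sumℚ (Listₚ.map-++ jointPmf (filterᵇ P xs) _) ⟩
  sumℚ (map jointPmf (filterᵇ P xs) ++ map jointPmf (filterᵇ P ys)) ≡⟨ sum-++ (map jointPmf (filterᵇ P xs)) _ ⟩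
  mass P xs + mass P ys                                        ∎
  where open ≡-Reasoning

mass-concatMap : ∀ {A : Set} {n} (P : Vec ℕ n → Bool) (g : A → List (Vec ℕ n)) xs →
                 mass P (concatMap g xs) ≡ sumℚ (map (mass P ∘ g) xs)
mass-concatMap P g []       = refl
mass-concatMap P g (x ∷ xs) =
  trans (mass-++ P (g x) (concatMap g xs)) (cong (_+_ (mass P (g x))) (mass-concatMap P g xs))

mass-cons : ∀ {n} (P : Vec ℕ (suc n) → Bool) x ws →
            mass P (map (x Vec.∷_) ws) ≡ ½ ^ᵠ x * mass (P ∘ (x Vec.∷_)) ws
mass-cons P x []       = sym (ℚₚ.*-zeroʳ (½ ^ᵠ x))
mass-cons P x (w ∷ ws) with P (x Vec.∷ w)
... | true  = trans (cong (_+_ (½ ^ᵠ x * jointPmf w)) (mass-cons P x ws))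
                    (sym (ℚₚ.*-distribˡ-+ (½ ^ᵠ x) (jointPmf w) _))
... | false = mass-cons P x ws

-- Independence: condition on the first coordinate.
mass-tuples-suc : ∀ {n} (P : Vec ℕ (suc n) → Bool) k →
                  mass P (tuples (suc n) k) ≡ sumℚ (map (λ x → ½ ^ᵠ x * mass (P ∘ (x Vec.∷_)) (tuples n k)) (oneTo k))
mass-tuples-suc {n} P k = trans (mass-concatMap P (λ x → map (x Vec.∷_) (tuples n k)) (oneTo k))
                                (sum-cong (λ x → mass-cons P x (tuples n k)) (oneTo k))

mass-cong : ∀ {n} {P Q : Vec ℕ n → Bool} → (∀ v → P v ≡ Q v) → ∀ vs → mass P vs ≡ mass Q vs
mass-cong P≗Q vs = cong (sumℚ ∘ map jointPmf)
  (Listₚ.filter-≐ (T? ∘ _) (T? ∘ _) ((λ {v} → subst T (P≗Q v)) , (λ {v} → subst T (sym (P≗Q v)))) vs)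

mass-all : ∀ {n} {P : Vec ℕ n → Bool} {vs} → All (T ∘ P) vs → mass P vs ≡ mass (λ _ → true) vs
mass-all {vs = vs} all = cong (sumℚ ∘ map jointPmf)
  (trans (Listₚ.filter-all (T? ∘ _) all) (sym (Listₚ.filter-all (T? ∘ _) (All.universal _ vs))))

oneTo-bounded : ∀ k → All (ℕ._≤ k) (oneTo k)
oneTo-bounded k = Allₚ.map⁺ (Allₚ.all-upTo k)

tuples-bounded : ∀ n k → All (λ v → maxV v ℕ.≤ k) (tuples n k)
tuples-bounded zero    k = z≤n All.∷ All.[]
tuples-bounded (suc n) k = Allₚ.concat⁺ (Allₚ.map⁺ (All.map extend (oneTo-bounded k)))
  where
  extend : ∀ {x} → x ℕ.≤ k → All (λ v → maxV v ℕ.≤ k) (map (x Vec.∷_) (tuples n k))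
  extend x≤k = Allₚ.map⁺ (All.map (ℕₚ.⊔-lub x≤k) (tuples-bounded n k))

cdfMax : ℕ → ℕ → ℚ
cdfMax n k = mass (λ _ → true) (tuples n k)

cdfMax-closed : ∀ n k → cdfMax n k ≡ cdf k ^ᵠ n
cdfMax-closed zero    k = refl
cdfMax-closed (suc n) k = begin
  cdfMax (suc n) k                                      ≡⟨ mass-tuples-suc (λ _ → true) k ⟩
  sumℚ (map (λ x → ½ ^ᵠ x * cdfMax n k) (oneTo k))      ≡⟨ sum-cong (λ x → ℚₚ.*-comm (½ ^ᵠ x) (cdfMax n k)) (oneTo k) ⟩
  sumℚ (map (λ x → cdfMax n k * ½ ^ᵠ x) (oneTo k))      ≡⟨ sum-*ˡ (cdfMax n k) (½ ^ᵠ_) (oneTo k) ⟩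
  cdfMax n k * cdf k                                    ≡⟨ ℚₚ.*-comm (cdfMax n k) (cdf k) ⟩
  cdf k * cdfMax n k                                    ≡⟨ cong (cdf k *_) (cdfMax-closed n k) ⟩
  cdf k ^ᵠ suc n                                        ∎
  where open ≡-Reasoning

<⇒≡ᵇ-false : ∀ {x k} → x ℕ.< k → (x ≡ᵇ k) ≡ false
<⇒≡ᵇ-false {zero}  {suc k} _         = refl
<⇒≡ᵇ-false {suc x} {suc k} (s≤s x<k) = <⇒≡ᵇ-false x<k

⊔-≡ᵇ-below : ∀ {x k} m → x ℕ.≤ k → ((x ⊔ m) ≡ᵇ suc k) ≡ (m ≡ᵇ suc k)
⊔-≡ᵇ-below {zero}          m       _         = refl
⊔-≡ᵇ-below {suc x}         zero    x≤k       = <⇒≡ᵇ-false (s≤s x≤k)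
⊔-≡ᵇ-below {suc x} {suc k} (suc m) (s≤s x≤k) = ⊔-≡ᵇ-below m x≤k

-- Pr[Z = k+1] for n+1 variables: either X₁ ≤ k and the other n have maximum k+1,
-- or X₁ = k+1 and the other n are at most k+1.
PrZ-suc : ∀ n k → PrZ (suc n) (suc k) ≡ cdf k * PrZ n (suc k) + ½ ^ᵠ suc k * cdfMax n (suc k)
PrZ-suc n k = begin
  PrZ (suc n) (suc k)                                    ≡⟨ mass-tuples-suc {n} (λ v → maxV v ≡ᵇ suc k) (suc k) ⟩
  sumℚ (map h (oneTo (suc k)))                           ≡⟨ sum-oneTo-suc h k ⟩
  sumℚ (map h (oneTo k)) + h (suc k)                     ≡⟨ cong₂ _+_ first-below first-top ⟩
  sumℚ (map (λ x → ½ ^ᵠ x * p) (oneTo k)) + r * cdfMax n (suc k)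
                                                         ≡⟨ cong (_+ r * cdfMax n (suc k)) (sum-*ʳ p (½ ^ᵠ_) (oneTo k)) ⟩
  cdf k * p + r * cdfMax n (suc k)                       ∎
  where
  open ≡-Reasoning
  p = PrZ n (suc k)
  r = ½ ^ᵠ suc k
  h : ℕ → ℚ
  h x = ½ ^ᵠ x * mass (λ w → (x ⊔ maxV w) ≡ᵇ suc k) (tuples n (suc k))
  first-below : sumℚ (map h (oneTo k)) ≡ sumℚ (map (λ x → ½ ^ᵠ x * p) (oneTo k))
  first-below = sum-cong-All (All.map below (oneTo-bounded k))
    where
    below : ∀ {x} → x ℕ.≤ k → h x ≡ ½ ^ᵠ x * p
    below {x} x≤k = cong (½ ^ᵠ x *_) (mass-cong (λ w → ⊔-≡ᵇ-below (maxV w) x≤k) (tuples n (suc k)))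
  first-top : h (suc k) ≡ r * cdfMax n (suc k)
  first-top = cong (r *_) (mass-all {P = λ w → (suc k ⊔ maxV w) ≡ᵇ suc k} (All.map (λ {w} → top {w}) (tuples-bounded n (suc k))))
    where
    top : ∀ {w} → maxV w ℕ.≤ suc k → T ((suc k ⊔ maxV w) ≡ᵇ suc k)
    top {w} w≤k = ℕₚ.≡⇒≡ᵇ (suc k ⊔ maxV w) (suc k) (ℕₚ.m≥n⇒m⊔n≡m w≤k)

PrZ-closed : ∀ n k → PrZ n (suc k) ≡ cdf (suc k) ^ᵠ n - cdf k ^ᵠ n
PrZ-closed zero    k = refl
PrZ-closed (suc n) k = begin
  PrZ (suc n) (suc k)                         ≡⟨ PrZ-suc n k ⟩
  c * PrZ n (suc k) + r * cdfMax n (suc k)    ≡⟨ cong₂ (λ a b → c * a + r * b) (PrZ-closed n k) (cdfMax-closed n (suc k)) ⟩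
  c * (c' ^ᵠ n - c ^ᵠ n) + r * c' ^ᵠ n        ≡⟨ solve 4 (λ c r A B → c :* (A :- B) :+ r :* A := (c :+ r) :* A :- c :* B)
                                                   refl c r (c' ^ᵠ n) (c ^ᵠ n) ⟩
  (c + r) * c' ^ᵠ n - c * c ^ᵠ n              ≡⟨ cong (λ z → z * c' ^ᵠ n - c * c ^ᵠ n) (sum-oneTo-suc (½ ^ᵠ_) k) ⟨
  c' ^ᵠ suc n - c ^ᵠ suc n                    ∎
  where
  open ≡-Reasoning
  c  = cdf k
  c' = cdf (suc k)
  r  = ½ ^ᵠ suc k

-- The partial sums as a combination of geometric series.

-- The j-th series has ratio qⱼ = 2^{-(j+1)} and coefficient dⱼ = 1/(2^{j+1}-1) - 1.
q : ℕ → ℚ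
q j = ½ ^ᵠ suc j

d : ℕ → ℚ
d j = invDen j - 1ℚ

-- dⱼ (1 - qⱼ) = 2⁻ʲ - 1, from 2^{j+1}·qⱼ = 1 and (2^{j+1} - 1)·invDen j = 1.
d-spec : ∀ j → d j * (1ℚ - q j) ≡ ½ ^ᵠ j - 1ℚ
d-spec j = begin
  (D - 1ℚ) * (1ℚ - ½ * p)                                 ≡⟨ solve 3 (λ D p e → (D :- con 1ℚ) :* (con 1ℚ :- con ½ :* p) :=
                                                                 (p :- con 1ℚ) :+ D :* (con 1ℚ :- e :* (con ½ :* p))
                                                                 :+ (con ½ :* p) :* ((e :- con 1ℚ) :* D :- con 1ℚ)) refl D p e ⟩
  (p - 1ℚ) + D * (1ℚ - e * (½ * p)) + (½ * p) * ((e - 1ℚ) * D - 1ℚ)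
                                                          ≡⟨ cong₂ (λ a b → (p - 1ℚ) + D * (1ℚ - a) + (½ * p) * (b - 1ℚ))
                                                                   (2^-inverse (suc j)) (invDen-inverse j) ⟩
  (p - 1ℚ) + D * (1ℚ - 1ℚ) + (½ * p) * (1ℚ - 1ℚ)          ≡⟨ solve 2 (λ D p → (p :- con 1ℚ) :+ D :* (con 1ℚ :- con 1ℚ)
                                                                 :+ (con ½ :* p) :* (con 1ℚ :- con 1ℚ) := p :- con 1ℚ) refl D p ⟩
  p - 1ℚ                                                  ∎
  where
  open ≡-Reasoning
  D = invDen j
  p = ½ ^ᵠ j
  e = ι (2 ℕ.^ suc j)

limit : ℕ → ℚ
limit n = sumℚ (map (λ j → signedBinom n j * d j) (upTo (suc n)))

tail : ℕ → ℕ → ℚ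
tail n N = sumℚ (map (λ j → signedBinom n j * d j * q j ^ᵠ N) (upTo (suc n)))

term-expansion : ∀ n N → PrZ n (suc N) * ½ ^ᵠ N ≡
                 sumℚ (map (λ j → signedBinom n j * ((½ ^ᵠ j - 1ℚ) * q j ^ᵠ N)) (upTo (suc n)))
term-expansion n N = begin
  PrZ n (suc N) * x                                   ≡⟨ cong (_* x) (PrZ-closed n N) ⟩
  (cdf (suc N) ^ᵠ n - cdf N ^ᵠ n) * x                 ≡⟨ cong₂ (λ a b → (a ^ᵠ n - b ^ᵠ n) * x) (cdf-closed (suc N)) (cdf-closed N) ⟩
  ((1ℚ - ½ * x) ^ᵠ n - (1ℚ - x) ^ᵠ n) * x             ≡⟨ cong₂ (λ a b → (a - b) * x) (binomial n (½ * x)) (binomial n x) ⟩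
  (sumℚ (map f js) - sumℚ (map g js)) * x             ≡⟨ cong (_* x) (sum-- f g js) ⟨
  sumℚ (map (λ j → f j - g j) js) * x                 ≡⟨ sum-*ʳ x (λ j → f j - g j) js ⟨
  sumℚ (map (λ j → (f j - g j) * x) js)               ≡⟨ sum-cong regroup js ⟩
  sumℚ (map (λ j → signedBinom n j * ((½ ^ᵠ j - 1ℚ) * q j ^ᵠ N)) js) ∎
  where
  open ≡-Reasoning
  js = upTo (suc n)
  x = ½ ^ᵠ N
  f g : ℕ → ℚ
  f j = signedBinom n j * (½ * x) ^ᵠ j
  g j = signedBinom n j * x ^ᵠ j
  -- (2^{-(N+1)})ʲ = 2⁻ʲ·(2^{-N})ʲ  and  qⱼᴺ = 2^{-N}·(2^{-N})ʲ
  regroup : ∀ j → (f j - g j) * x ≡ signedBinom n j * ((½ ^ᵠ j - 1ℚ) * q j ^ᵠ N)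
  regroup j rewrite ^ᵠ-distrib-* ½ x j | ^ᵠ-comm ½ (suc j) N =
    solve 4 (λ c p y x → (c :* (p :* y) :- c :* y) :* x := c :* ((p :- con 1ℚ) :* (x :* y)))
            refl (signedBinom n j) (½ ^ᵠ j) (x ^ᵠ j) x

-- E_N = E_{N+1} + Pr[Z = N+1]·2^{-N}: the tail loses exactly the next term of W.
tail-step : ∀ n N → tail n N ≡ tail n (suc N) + PrZ n (suc N) * ½ ^ᵠ N
tail-step n N = begin
  tail n N                                              ≡⟨ sum-cong split (upTo (suc n)) ⟩
  sumℚ (map (λ j → a j + b j) (upTo (suc n)))           ≡⟨ sum-+ a b (upTo (suc n)) ⟩
  tail n (suc N) + sumℚ (map b (upTo (suc n)))          ≡⟨ cong (_+_ (tail n (suc N))) (term-expansion n N) ⟨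
  tail n (suc N) + PrZ n (suc N) * ½ ^ᵠ N               ∎
  where
  open ≡-Reasoning
  a b : ℕ → ℚ
  a j = signedBinom n j * d j * q j ^ᵠ suc N
  b j = signedBinom n j * ((½ ^ᵠ j - 1ℚ) * q j ^ᵠ N)
  split : ∀ j → signedBinom n j * d j * q j ^ᵠ N ≡ a j + b j
  split j = begin
    c * d j * Q                                          ≡⟨ solve 4 (λ c d q Q → c :* d :* Q :=
                                                               c :* d :* (q :* Q) :+ c :* ((d :* (con 1ℚ :- q)) :* Q))
                                                               refl c (d j) (q j) Q ⟩
    c * d j * (q j * Q) + c * ((d j * (1ℚ - q j)) * Q)   ≡⟨ cong (λ z → c * d j * (q j * Q) + c * (z * Q)) (d-spec j) ⟩
    a j + b j                                            ∎
    where c = signedBinom n j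
          Q = q j ^ᵠ N

Wpartial-suc : ∀ n N → Wpartial n (suc N) ≡ Wpartial n N + PrZ n (suc N) * ½ ^ᵠ N
Wpartial-suc n N = sum-oneTo-suc (λ k → PrZ n k * ½ ^ᵠ (k ∸ 1)) N

Wpartial-closed : ∀ n N → Wpartial n N ≡ limit n - tail n N
Wpartial-closed n zero = sym (begin
  limit n - tail n 0   ≡⟨ cong (_-_ (limit n)) (sum-cong (λ j → ℚₚ.*-identityʳ (signedBinom n j * d j)) (upTo (suc n))) ⟩
  limit n - limit n    ≡⟨ ℚₚ.+-inverseʳ (limit n) ⟩
  0ℚ                   ∎)
  where open ≡-Reasoning
Wpartial-closed n (suc N) = begin
  Wpartial n (suc N)                 ≡⟨ Wpartial-suc n N ⟩
  Wpartial n N + t                   ≡⟨ cong (_+ t) (Wpartial-closed n N) ⟩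
  limit n - tail n N + t             ≡⟨ cong (λ e → limit n - e + t) (tail-step n N) ⟩
  limit n - (tail n (suc N) + t) + t ≡⟨ solve 3 (λ l e t → l :- (e :+ t) :+ t := l :- e) refl (limit n) (tail n (suc N)) t ⟩
  limit n - tail n (suc N)           ∎
  where
  open ≡-Reasoning
  t = PrZ n (suc N) * ½ ^ᵠ N

-- For n ≥ 1, L = Σⱼ cⱼ/(2^{j+1}-1) - Σⱼ cⱼ = RHS.
limit-value : ∀ m → limit (suc m) ≡ RHS (suc m)
limit-value m = begin
  limit n                                                 ≡⟨ sum-cong expand js ⟩
  sumℚ (map (λ j → rhsTerm j - signedBinom n j) js)       ≡⟨ sum-- rhsTerm (signedBinom n) js ⟩
  RHS n - sumℚ (map (signedBinom n) js)                   ≡⟨ cong (_-_ (RHS n)) (signedBinom-sum m) ⟩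
  RHS n - 0ℚ                                              ≡⟨ ℚₚ.+-identityʳ (RHS n) ⟩
  RHS n                                                   ∎
  where
  open ≡-Reasoning
  n  = suc m
  js = upTo (suc n)
  rhsTerm : ℕ → ℚ
  rhsTerm j = sign j * (ι (n C j) * invDen j)
  expand : ∀ j → signedBinom n j * d j ≡ rhsTerm j - signedBinom n j
  expand j = solve 3 (λ s c D → (s :* c) :* (D :- con 1ℚ) := s :* (c :* D) :- s :* c)
                     refl (sign j) (ι (n C j)) (invDen j)

error-is-tail : ∀ m N → Wpartial (suc m) N - RHS (suc m) ≡ - tail (suc m) N
error-is-tail m N = begin
  Wpartial n N - RHS n             ≡⟨ cong (_- RHS n) (Wpartial-closed n N) ⟩
  limit n - tail n N - RHS n       ≡⟨ cong (λ l → l - tail n N - RHS n) (limit-value m) ⟩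
  RHS n - tail n N - RHS n         ≡⟨ solve 2 (λ r e → r :- e :- r := :- e) refl (RHS n) (tail n N) ⟩
  - tail n N                       ∎
  where
  open ≡-Reasoning
  n = suc m

tailConst : ℕ → ℚ
tailConst n = sumℚ (map (λ j → ∣ signedBinom n j * d j ∣) (upTo (suc n)))

q^N≤½^K : ∀ j {K N} → K ℕ.≤ N → q j ^ᵠ N ≤ ½ ^ᵠ K
q^N≤½^K j {K} {N} K≤N = ℚₚ.≤-trans (^ᵠ-mono-≤ (^ᵠ-nonNeg 0≤½ (suc j)) q≤½ N) (^ᵠ-antitone 0≤½ ½≤1 K≤N)
  where
  q≤½ : q j ≤ ½
  q≤½ = ℚₚ.≤-trans (*-monoˡ-≤ ½ 0≤½ (^ᵠ-antitone 0≤½ ½≤1 {N = j} z≤n)) (ℚₚ.≤-reflexive (ℚₚ.*-identityʳ ½))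

tail-bound : ∀ n {K N} → K ℕ.≤ N → ∣ tail n N ∣ ≤ tailConst n * ½ ^ᵠ K
tail-bound n {K} {N} K≤N = begin
  ∣ tail n N ∣                                           ≤⟨ sum-abs (λ j → signedBinom n j * d j * q j ^ᵠ N) js ⟩
  sumℚ (map (λ j → ∣ signedBinom n j * d j * q j ^ᵠ N ∣) js) ≤⟨ sum-mono-≤ termwise js ⟩
  sumℚ (map (λ j → ∣ signedBinom n j * d j ∣ * ½ ^ᵠ K) js)  ≡⟨ sum-*ʳ (½ ^ᵠ K) (λ j → ∣ signedBinom n j * d j ∣) js ⟩
  tailConst n * ½ ^ᵠ K                                   ∎
  where
  open ℚₚ.≤-Reasoning
  js = upTo (suc n)
  termwise : ∀ j → ∣ signedBinom n j * d j * q j ^ᵠ N ∣ ≤ ∣ signedBinom n j * d j ∣ * ½ ^ᵠ K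
  termwise j = begin
    ∣ c * q j ^ᵠ N ∣        ≡⟨ ℚₚ.∣p*q∣≡∣p∣*∣q∣ c (q j ^ᵠ N) ⟩
    ∣ c ∣ * ∣ q j ^ᵠ N ∣    ≡⟨ cong (∣ c ∣ *_) (ℚₚ.0≤p⇒∣p∣≡p (^ᵠ-nonNeg (^ᵠ-nonNeg 0≤½ (suc j)) N)) ⟩
    ∣ c ∣ * q j ^ᵠ N        ≤⟨ *-monoˡ-≤ ∣ c ∣ (ℚₚ.0≤∣p∣ c) (q^N≤½^K j K≤N) ⟩
    ∣ c ∣ * ½ ^ᵠ K          ∎
    where c = signedBinom n j * d j

error-bound : ∀ m {K N} → K ℕ.≤ N → ∣ Wpartial (suc m) N - RHS (suc m) ∣ ≤ tailConst (suc m) * ½ ^ᵠ K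
error-bound m {K} {N} K≤N = begin
  ∣ Wpartial (suc m) N - RHS (suc m) ∣   ≡⟨ cong ∣_∣ (error-is-tail m N) ⟩
  ∣ - tail (suc m) N ∣                   ≡⟨ ℚₚ.∣-p∣≡∣p∣ (tail (suc m) N) ⟩
  ∣ tail (suc m) N ∣                     ≤⟨ tail-bound (suc m) K≤N ⟩
  tailConst (suc m) * ½ ^ᵠ K             ∎
  where open ℚₚ.≤-Reasoning

lemmaA1 : (n : ℕ) → n ℕ.≥ 1 →
          (ε : ℚ) → 0ℚ < ε →
          ∃ λ K → (N : ℕ) → K ℕ.≤ N → ∣ Wpartial n N - RHS n ∣ < ε
lemmaA1 zero    ()
lemmaA1 (suc m) _ ε 0<ε =
  let K , M·2⁻ᴷ<ε = eventually-small (tailConst (suc m)) ε 0<ε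
  in  K , λ N K≤N → ℚₚ.≤-<-trans (error-bound m K≤N) M·2⁻ᴷ<ε
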